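{- Let $A=\{0,1,\dots,m\}$ with $m\ge 1$, let $\ell\ge 2$ be an integer, and let $v\in A^*$ with $|v|\le \ell-3$. Then the word $w=m(m-1)m^{\ell-2}v$ (the letter $m$, the letter $m-1$, $\ell-2$ copies of $m$, then $v$) is a Nyldon word.
   Context: $A=\{0,1,\dots,m\}$ is ordered $0<1<\cdots<m$. The lexicographic order $<_{\text{lex}}$ on $A^*$: $u<_{\text{lex}}v$ if $u$ is a proper prefix of $v$, or there are a word $p$ and letters $i<j$ with $pi$ a prefix of $u$ and $pj$ a prefix of $v$. Nyldon words are defined recursively: a nonempty word $w$ is Nyldon if $w$ is a single letter, or $w$ cannot be written as $w=w_1w_2\cdots w_k$ with $k\ge 2$, each $w_i$ Nyldon, and $w_1\le_{\text{lex}}w_2\le_{\text{lex}}\cdots\le_{\text{lex}}w_k$. -}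

module Defs where

open import Data.Nat using (ℕ; zero; suc; _≤_; _<_)
open import Data.Fin using (Fin)
import Data.Fin as F
open import Data.List using (List; []; _∷_; [_]; length; concat)
open import Data.List.Relation.Unary.All using (All)
open import Data.Product using (Σ; ∃; _×_; _,_)
open import Data.Sum using (_⊎_)
open import Relation.Nullary using (¬_)
open import Data.Empty using (⊥)
open import Relation.Binary.PropositionalEquality using (_≡_; _≢_)

Word : ℕ → Set
Word m = List (Fin (suc m))

data _<lex_ {m : ℕ} : Word m → Word m → Set where
  prefix : ∀ {a v} → [] <lex (a ∷ v)
  letter : ∀ {i j u v} → i F.< j → (i ∷ u) <lex (j ∷ v)
  same   : ∀ {a u v} → u <lex v → (a ∷ u) <lex (a ∷ v)

_≤lex_ : {m : ℕ} → Word m → Word m → Set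
u ≤lex v = (u <lex v) ⊎ (u ≡ v)

data LexSorted {m : ℕ} : List (Word m) → Set where
  []  : LexSorted []
  [-] : ∀ {w} → LexSorted (w ∷ [])
  _∷_ : ∀ {u v ws} → u ≤lex v → LexSorted (v ∷ ws) → LexSorted (u ∷ v ∷ ws)

-- Since every factor in a
-- factorisation into k ≥ 2 nonempty words is strictly shorter than the word,
-- the recursion is made structural by a fuel parameter; the fuel
-- length w suffices (IsNyldonF n w does not depend on n once n ≥ |w|).
IsNyldonF : {m : ℕ} → ℕ → Word m → Set
NyldonFact : {m : ℕ} → ℕ → Word m → Set

IsNyldonF zero w = ⊥
IsNyldonF (suc n) w =
  (∃ λ a → w ≡ [ a ]) ⊎ ((w ≢ []) × ¬ NyldonFact n w)

NyldonFact {m} n w =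
  Σ (List (Word m)) λ ws →
    (2 ≤ length ws) × (concat ws ≡ w) × All (IsNyldonF n) ws × LexSorted ws

IsNyldon : {m : ℕ} → Word m → Set
IsNyldon w = IsNyldonF (length w) w

-- Suppose w = M P Mⁿ⁺¹ v (M the largest letter, P its predecessor, |v| ≤ n) factors into Nyldon
-- words w₁ ≤lex w₂ ≤lex ⋯. As w₁ starts with M, so does w₂; hence w₁ ≠ M (the next letter is P)
-- and w₁ = M P w₁′. Then w₂ = M d ⋯ with d ≥ P, and d = M is impossible because a Nyldon word of
-- length ≥ 2 starts with a strict descent. So w₂ = M P z with w₁′ ≤lex z. But this second factor
-- M P lies beyond the block Mⁿ⁺¹, so w₁′ begins with Mⁿ while |z| < |v| ≤ n: a contradiction.
module Submission where

open import Defs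
open import Data.Nat using (ℕ; zero; suc; _≤_; _<_; _+_; _∸_; z≤n; s≤s; s≤s⁻¹; s<s⁻¹)
open import Data.Nat.Properties
  using (≤-refl; ≤-trans; ≤-reflexive; ≤-<-trans; <-≤-trans; ≤⇒≯; n<1+n; m<n⇒m<1+n; m≤n⇒m≤1+n; m+n≤o⇒n≤o; m+n≤o⇒m≤o∸n)
open import Data.Fin using (Fin; toℕ; fromℕ; inject₁)
import Data.Fin as F
open import Data.Fin.Properties using (≤fromℕ; ≤∧≢⇒<; fromℕ≢inject₁)
open import Data.List using (List; []; _∷_; [_]; _++_; concat; replicate; length)
open import Data.List.Properties using (∷-injective; ++-identityʳ; length-++-≤ˡ; length-++-≤ʳ)
open import Data.List.Relation.Unary.All using (All; []; _∷_)
import Data.List.Relation.Unary.All as All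
open import Data.Product using (∃-syntax; _×_; _,_; proj₁; proj₂)
open import Data.Sum using (_⊎_; inj₁; inj₂)
open import Data.Empty using (⊥-elim)
open import Function using (_∘_)
open import Relation.Nullary using (¬_; yes; no)
open import Relation.Binary.PropositionalEquality using (_≡_; _≢_; refl; sym; cong)

private variable
  m f : ℕ

∷-≤lex-∷⁻ : {a b : Fin (suc m)} {u v : Word m} → (a ∷ u) ≤lex (b ∷ v) → a F.< b ⊎ (a ≡ b × u ≤lex v)
∷-≤lex-∷⁻ (inj₁ (letter a<b)) = inj₁ a<b
∷-≤lex-∷⁻ (inj₁ (same u<v))   = inj₂ (refl , inj₁ u<v)
∷-≤lex-∷⁻ (inj₂ refl)         = inj₂ (refl , inj₂ refl)

∷-≰lex-[] : {a : Fin (suc m)} {u : Word m} → ¬ (a ∷ u) ≤lex []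
∷-≰lex-[] (inj₁ ())
∷-≰lex-[] (inj₂ ())

fromℕ-≮ : {c : Fin (suc m)} → ¬ fromℕ m F.< c
fromℕ-≮ {c = c} = ≤⇒≯ (≤fromℕ c)

fromℕ∷-≤lex⁻ : {b : Fin (suc m)} {u v : Word m} → (fromℕ m ∷ u) ≤lex (b ∷ v) → b ≡ fromℕ m × u ≤lex v
fromℕ∷-≤lex⁻ le with ∷-≤lex-∷⁻ le
... | inj₁ top<b        = ⊥-elim (fromℕ-≮ top<b)
... | inj₂ (refl , u≤v) = refl , u≤v

[-]-≤lex : {a c : Fin (suc m)} {u : Word m} → a F.≤ c → [ a ] ≤lex (c ∷ u)
[-]-≤lex {a = a} {c = c} {u = u} a≤c with a F.≟ c | u
... | no a≢c  | _     = inj₁ (letter (≤∧≢⇒< a≤c a≢c))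
... | yes refl | []    = inj₂ refl
... | yes refl | _ ∷ _ = inj₁ (same prefix)

replicate-fromℕ-≰lex : ∀ n {t z : Word m} → length z < n → ¬ (replicate n (fromℕ m) ++ t) ≤lex z
replicate-fromℕ-≰lex (suc n) {z = []}    _         le = ∷-≰lex-[] le
replicate-fromℕ-≰lex (suc n) {z = _ ∷ _} (s≤s |z|<n) le =
  let (_ , le′) = fromℕ∷-≤lex⁻ le in replicate-fromℕ-≰lex n |z|<n le′

replicate-++-split : ∀ n {a b : Fin (suc m)} {x s v : Word m} → b ≢ a →
  x ++ a ∷ b ∷ s ≡ replicate (suc n) a ++ v →
  ∃[ t ] x ≡ replicate n a ++ t × t ++ a ∷ b ∷ s ≡ a ∷ v
replicate-++-split zero    {x = x}     _   eq = x , refl , eq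
replicate-++-split (suc n) {x = []}    b≢a eq = ⊥-elim (b≢a (proj₁ (∷-injective (proj₂ (∷-injective eq)))))
replicate-++-split (suc n) {x = _ ∷ x} b≢a eq with ∷-injective eq
... | refl , eq′ = let (t , x≡ , t≡) = replicate-++-split n b≢a eq′ in t , cong (_ ∷_) x≡ , t≡

++-∷-length< : ∀ (t : Word m) {a u v} → t ++ a ∷ u ≡ v → length u < length v
++-∷-length< []      refl = n<1+n _
++-∷-length< (_ ∷ t) refl = m<n⇒m<1+n (++-∷-length< t refl)

IsNyldonF⇒≢[] : ∀ f {w : Word m} → IsNyldonF f w → w ≢ []
IsNyldonF⇒≢[] (suc f) (inj₁ (_ , refl)) ()
IsNyldonF⇒≢[] (suc f) (inj₂ (w≢[] , _))  = w≢[]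

length≤length-concat : ∀ (ws : List (Word m)) → All (λ x → length x ≤ length (concat ws)) ws
length≤length-concat []       = []
length≤length-concat (x ∷ ws) =
  length-++-≤ˡ x ∷ All.map (λ h → ≤-trans h (length-++-≤ʳ (concat ws) {x})) (length≤length-concat ws)

length<length-++-∷ : ∀ (x : Word m) {a y} → length x < length (x ++ a ∷ y)
length<length-++-∷ []      = s≤s z≤n
length<length-++-∷ (_ ∷ x) = s≤s (length<length-++-∷ x)

factors-shorter : ∀ {ws : List (Word m)} → 2 ≤ length ws → All (_≢ []) ws →
  All (λ x → length x < length (concat ws)) ws
factors-shorter {ws = []}                     ()
factors-shorter {ws = _ ∷ []}                 (s≤s ())
factors-shorter {ws = [] ∷ _ ∷ _}             _ (≢[] ∷ _)     = ⊥-elim (≢[] refl)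
factors-shorter {ws = _ ∷ [] ∷ _}             _ (_ ∷ ≢[] ∷ _) = ⊥-elim (≢[] refl)
factors-shorter {ws = (c ∷ x) ∷ (d ∷ y) ∷ ws} _ _ =
  length<length-++-∷ (c ∷ x)
  ∷ All.map (λ h → s≤s (≤-trans h (length-++-≤ʳ _ {x}))) (length≤length-concat ((d ∷ y) ∷ ws))

IsNyldonF-fuel : ∀ f g {w : Word m} → length w ≤ f → length w ≤ g → IsNyldonF f w → IsNyldonF g w
NyldonFact-fuel : ∀ f g {w : Word m} → length w ≤ suc f → length w ≤ suc g →
  NyldonFact f w → NyldonFact g w

IsNyldonF-fuel zero    _            _   _   ()
IsNyldonF-fuel (suc f) zero    {[]} _   _   ny                    = ⊥-elim (IsNyldonF⇒≢[] (suc f) ny refl)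
IsNyldonF-fuel (suc f) (suc g)      _   _   (inj₁ w≡[a])          = inj₁ w≡[a]
IsNyldonF-fuel (suc f) (suc g)      w≤f w≤g (inj₂ (w≢[] , ¬fact)) =
  inj₂ (w≢[] , ¬fact ∘ NyldonFact-fuel g f w≤g w≤f)

NyldonFact-fuel f g w≤f w≤g (ws , two , refl , nys , sorted) =
  ws , two , refl , All.zipWith refuel (shorter , nys) , sorted
  where
  shorter = factors-shorter two (All.map (IsNyldonF⇒≢[] f) nys)
  refuel : ∀ {x} → length x < length (concat ws) × IsNyldonF f x → IsNyldonF g x
  refuel (x< , ny) = IsNyldonF-fuel f g (s≤s⁻¹ (≤-trans x< w≤f)) (s≤s⁻¹ (≤-trans x< w≤g)) ny

-- a ∷ c ∷ z factors as a · (c ∷ z) if c ∷ z is Nyldon, and as a · (a factorisation of c ∷ z)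
-- otherwise; constructively, the second case is what establishes that c ∷ z is Nyldon.
¬IsNyldonF-∷-≤ : ∀ {a c : Fin (suc m)} {z} → length (a ∷ c ∷ z) ≤ f → a F.≤ c →
  ¬ IsNyldonF f (a ∷ c ∷ z)
¬IsNyldonF-∷-≤ {f = suc (suc g)} {a} {c} {z} (s≤s cz≤) a≤c (inj₁ (_ , eq)) with ∷-injective eq
... | _ , ()
¬IsNyldonF-∷-≤ {f = suc (suc g)} {a} {c} {z} (s≤s cz≤) a≤c (inj₂ (_ , ¬fact)) =
  ¬fact (split-off-a ((c ∷ z) ∷ []) (++-identityʳ (c ∷ z)) (tail-Nyldon ∷ []) [-])
  where
  split-off-a : ∀ ws → concat ws ≡ c ∷ z → All (IsNyldonF (suc g)) ws → LexSorted ws →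
    NyldonFact (suc g) (a ∷ c ∷ z)
  split-off-a ([] ∷ ws)      _  (ny ∷ _) _      = ⊥-elim (IsNyldonF⇒≢[] (suc g) ny refl)
  split-off-a ((d ∷ x) ∷ ws) eq nys      sorted with ∷-injective eq
  ... | refl , _ = [ a ] ∷ (d ∷ x) ∷ ws , s≤s (s≤s z≤n) , cong (a ∷_) eq ,
                   inj₁ (a , refl) ∷ nys , [-]-≤lex a≤c ∷ sorted
  tail-Nyldon : IsNyldonF (suc g) (c ∷ z)
  tail-Nyldon = inj₂ ((λ ()) , λ fact → ¬fact (lift fact))
    where
    lift : NyldonFact g (c ∷ z) → NyldonFact (suc g) (a ∷ c ∷ z)
    lift fact =
      let (ws , _ , eq , nys , sorted) = NyldonFact-fuel g (suc g) {c ∷ z} cz≤ (m≤n⇒m≤1+n cz≤) fact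
      in split-off-a ws eq nys sorted

inject₁-fromℕ<⇒≡fromℕ : ∀ k {c : Fin (suc (suc k))} → inject₁ (fromℕ k) F.< c → c ≡ fromℕ (suc k)
inject₁-fromℕ<⇒≡fromℕ zero    {F.suc F.zero} _ = refl
inject₁-fromℕ<⇒≡fromℕ (suc k) {F.suc c}      h = cong F.suc (inject₁-fromℕ<⇒≡fromℕ k (s<s⁻¹ h))

module _ (k n : ℕ) (v : Word (suc k)) (|v|≤n : length v ≤ n) where

  private
    M P : Fin (suc (suc k))
    M = fromℕ (suc k)
    P = inject₁ (fromℕ k)

    R : Word (suc k)
    R = replicate (suc n) M ++ v

    fuel : ℕ
    fuel = suc (length R)

    -- w₁ = M P w₁′ must end inside the block of M's, so w₁′ ≤lex z is a comparison with a shorter word.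
    ¬≤lex-after-MP : ∀ w₁′ z s → w₁′ ++ M ∷ P ∷ z ++ s ≡ R → ¬ w₁′ ≤lex z
    ¬≤lex-after-MP w₁′ z s eq w₁′≤z
      with replicate-++-split n (fromℕ≢inject₁ ∘ sym) eq
    ... | t , refl , t≡ = replicate-fromℕ-≰lex n |z|<n w₁′≤z
      where
      |z|<n : length z < n
      |z|<n = ≤-<-trans (length-++-≤ˡ z) (<-≤-trans (s<s⁻¹ (++-∷-length< t t≡)) |v|≤n)

    ¬≤lex-MP : ∀ w₁′ w₂ s → w₁′ ++ M ∷ w₂ ++ s ≡ R → length (M ∷ w₂) ≤ fuel →
      IsNyldonF fuel (M ∷ w₂) → ¬ (P ∷ w₁′) ≤lex w₂
    ¬≤lex-MP w₁′ []      s _  _    _  le = ∷-≰lex-[] le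
    ¬≤lex-MP w₁′ (d ∷ z) s eq |w₂|≤ ny le with ∷-≤lex-∷⁻ le
    ... | inj₁ P<d with inject₁-fromℕ<⇒≡fromℕ k P<d
    ...   | refl = ¬IsNyldonF-∷-≤ |w₂|≤ (≤-refl {toℕ M}) ny
    ¬≤lex-MP w₁′ (d ∷ z) s eq |w₂|≤ ny le | inj₂ (refl , w₁′≤z) = ¬≤lex-after-MP w₁′ z s eq w₁′≤z

  ¬NyldonFact : ¬ NyldonFact fuel (M ∷ P ∷ R)
  ¬NyldonFact ([] , () , _)
  ¬NyldonFact (_ ∷ [] , s≤s () , _)
  ¬NyldonFact ([] ∷ _ , _ , _ , ny ∷ _ , _) = IsNyldonF⇒≢[] _ ny refl
  ¬NyldonFact (_ ∷ [] ∷ _ , _ , _ , _ ∷ ny ∷ _ , _) = IsNyldonF⇒≢[] _ ny refl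
  ¬NyldonFact ((c ∷ w₁) ∷ (d ∷ w₂) ∷ ws , two , eq , nys@(_ ∷ ny₂ ∷ _) , w₁≤w₂ ∷ _)
    with factors-shorter two (All.map (IsNyldonF⇒≢[] fuel) nys)
       | ∷-injective eq
  ... | _ ∷ |dw₂|< ∷ _ | refl , eq′ with fromℕ∷-≤lex⁻ w₁≤w₂
  ...   | refl , w₁≤w₂′ = second-letter w₁ eq′ w₁≤w₂′
    where
    |Mw₂|≤ : length (M ∷ w₂) ≤ fuel
    |Mw₂|≤ = s≤s⁻¹ (<-≤-trans |dw₂|< (≤-reflexive (cong length eq)))
    second-letter : ∀ w₁ → w₁ ++ M ∷ w₂ ++ concat ws ≡ P ∷ R → ¬ w₁ ≤lex w₂
    second-letter []        eq′ _ = fromℕ≢inject₁ (proj₁ (∷-injective eq′))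
    second-letter (e ∷ w₁′) eq′ with ∷-injective eq′
    ... | refl , eq″ = ¬≤lex-MP w₁′ w₂ (concat ws) eq″ |Mw₂|≤ ny₂

descent-fromℕ-power-Nyldon : ∀ k n (v : Word (suc k)) → length v ≤ n →
  IsNyldon (fromℕ (suc k) ∷ inject₁ (fromℕ k) ∷ (replicate (suc n) (fromℕ (suc k)) ++ v))
descent-fromℕ-power-Nyldon k n v |v|≤n = inj₂ ((λ ()) , ¬NyldonFact k n v |v|≤n)

lemma6p4 : (k : ℕ) → (ℓ : ℕ) → 2 ≤ ℓ → (v : Word (suc k)) → length v + 3 ≤ ℓ →
    IsNyldon (fromℕ (suc k) ∷ inject₁ (fromℕ k) ∷ (replicate (ℓ ∸ 2) (fromℕ (suc k)) ++ v))
lemma6p4 k zero                ()         _ _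
lemma6p4 k (suc zero)          (s≤s ())   _ _
lemma6p4 k (suc (suc zero))    _ v |v|+3≤ℓ with m+n≤o⇒n≤o (length v) |v|+3≤ℓ
... | s≤s (s≤s ())
lemma6p4 k (suc (suc (suc n))) _ v |v|+3≤ℓ =
  descent-fromℕ-power-Nyldon k n v (m+n≤o⇒m≤o∸n (length v) |v|+3≤ℓ)
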